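{- Let $H_n$ be a partial $n$-sun ($n \ge 3$). Then $Z(H_n) \le sdim(H_n)$.
   Context: A partial $n$-sun is a graph obtained from the cycle $C_n$ by attaching one new leaf (pendant vertex) to each vertex of some subset $U \subseteq V(C_n)$. Zero forcing: color each vertex black or white, with $S$ the initial set of black vertices; the color-change rule turns a white vertex $u_2$ black if it is the only white neighbor of some black vertex. $S$ is a zero forcing set if repeated application eventually makes all vertices black; $Z(G)$ is the minimum size of a zero forcing set. A vertex $x$ strongly resolves $u,v$ if $u$ lies on some shortest $x$–$v$ path or $v$ lies on some shortest $x$–$u$ path; $W$ is a strong resolving set if every pair of distinct vertices is strongly resolved by some vertex of $W$; $sdim(G)$ is the minimum size of a strong resolving set. -}

module Defs where

open import Data.Nat using (ℕ; zero; suc; _+_; _≤_; _∸_)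
open import Data.Fin using (Fin; toℕ)
open import Data.Fin.Subset using (Subset; _∈_)
open import Data.Empty using (⊥)
open import Data.Sum using (_⊎_)
open import Data.Product using (Σ; _×_; ∃)
open import Data.List using (List)
import Data.List.Membership.Propositional as L
open import Relation.Binary.PropositionalEquality using (_≡_; _≢_)

-- The partial n-sun H_n with leaf set U ⊆ V(C_n).
-- Cycle vertices are 0,…,n-1 (Fin n), with i ~ i+1 and n-1 ~ 0.
module PartialSun (n : ℕ) (U : Subset n) where

  data Vtx : Set where
    cyc  : Fin n → Vtx
    leaf : (i : Fin n) → i ∈ U → Vtx

  CycSucc : Fin n → Fin n → Set
  CycSucc i j = (toℕ j ≡ suc (toℕ i)) ⊎ ((toℕ i ≡ n ∸ 1) × (toℕ j ≡ 0))

  Adj : Vtx → Vtx → Set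
  Adj (cyc i)    (cyc j)    = CycSucc i j ⊎ CycSucc j i
  Adj (cyc i)    (leaf j _) = i ≡ j
  Adj (leaf i _) (cyc j)    = i ≡ j
  Adj (leaf _ _) (leaf _ _) = ⊥

  data Walk : Vtx → Vtx → ℕ → Set where
    [] : ∀ {x} → Walk x x 0
    _∷_ : ∀ {x y z k} → Adj x y → Walk y z k → Walk x z (suc k)

  data OnWalk (u : Vtx) : ∀ {x y k} → Walk x y k → Set where
    here  : ∀ {y k} (w : Walk u y k) → OnWalk u w
    there : ∀ {x y z k} (a : Adj x y) {w : Walk y z k} → OnWalk u w → OnWalk u (a ∷ w)

  IsShortest : ∀ {x y k} → Walk x y k → Set
  IsShortest {x} {y} {k} _ = ∀ {k'} → Walk x y k' → k ≤ k'

  OnShortestPath : Vtx → Vtx → Vtx → Set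
  OnShortestPath x v u = Σ ℕ λ k → Σ (Walk x v k) λ w → IsShortest w × OnWalk u w

  StronglyResolves : Vtx → Vtx → Vtx → Set
  StronglyResolves x u v = OnShortestPath x v u ⊎ OnShortestPath x u v

  IsStrongResolvingSet : List Vtx → Set
  IsStrongResolvingSet W =
    ∀ u v → u ≢ v → ∃ λ x → (x L.∈ W) × StronglyResolves x u v

  -- vertices eventually coloured black from initial black set S
  -- (least set containing S closed under the colour-change rule)
  data Black (S : List Vtx) : Vtx → Set where
    initial : ∀ {v} → v L.∈ S → Black S v
    force   : ∀ {b v} → Black S b → Adj b v →
              (∀ w → Adj b w → w ≢ v → Black S w) → Black S v

  IsZeroForcingSet : List Vtx → Set
  IsZeroForcingSet S = ∀ v → Black S v

-- Two distinct leaves are strongly resolved only by themselves, since a shortest path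
-- never passes through a leaf; so a strong resolving set W contains every leaf but at
-- most one. Conversely, if two adjacent cycle vertices are black and every leaf but one
-- is black, forcing sweeps around the cycle in both directions from the black pair up
-- to the base of the white leaf, after which every leaf is forced. If W contains all
-- leaves, or all but one together with a cycle vertex, such a set of size
-- max(2, |U|) ≤ |W| exists (|W| ≥ 2, as no vertex strongly resolves the two cycle
-- neighbours of its base). Otherwise W consists of the leaves off one position h.
-- On a cycle of diameter m = ⌊n/2⌋ such leaves resolve neither leaf h against a cycle
-- vertex at distance m from h, nor two leafless cycle vertices at distance m. Hence
-- h + m and h − m carry leaves, and so does h + 1 or h + m + 1; in either case all
-- leaves but one form a zero forcing set, of size |U| − 1 = |W|.
module Submission where

open import Defs

open import Data.Nat
  using (ℕ; zero; suc; pred; _+_; _∸_; _≤_; _<_; _⊓_; _⊔_; z≤n; s≤s; ∣_-_∣; ⌊_/2⌋; ⌈_/2⌉; NonZero; _≤?_; _<?_)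
open import Data.Nat.Properties
open import Data.Nat.DivMod using (_%_; _mod_; m%n<n; m<n⇒m%n≡m; [m+n]%n≡m%n; %-distribˡ-+; m%n%n≡m%n; n%n≡0)
open import Data.Fin using (Fin; toℕ) renaming (_≟_ to _≟ᶠ_)
open import Data.Fin.Subset using (Subset) renaming (_∈_ to _∈ₛ_; _∉_ to _∉ₛ_)
open import Data.Fin.Subset.Properties using () renaming (_∈?_ to _∈ₛ?_)
open import Data.Vec.Properties.WithK using ([]=-irrelevant)
open import Data.Fin.Properties using (toℕ-injective; toℕ-fromℕ<; toℕ<n)
open import Data.Product using (∃; ∃₂; _×_; _,_; proj₁; proj₂; uncurry)
open import Data.Sum using (_⊎_; inj₁; inj₂)
open import Data.Empty using (⊥; ⊥-elim)
open import Data.List using (List; length; []; _∷_; map; filter; allFin)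
open import Data.List.Properties using (length-removeAt′)
open import Data.List.Membership.Propositional using (_∈_; _∉_; _─_; find)
open import Data.List.Membership.Propositional.Properties
  using (∈-allFin; ∈-filter⁺; ∈-filter⁻; ∈-map∘filter⁺; ∈-map∘filter⁻)
import Data.List.Membership.DecPropositional as DecMembership
open import Data.List.Relation.Unary.Any as Any using (Any; here; there; any?)
open import Data.List.Relation.Unary.All as All using (All; all?)
open import Data.List.Relation.Unary.All.Properties using (¬All⇒Any¬)
open import Data.List.Relation.Unary.AllPairs using ([]; _∷_)
open import Data.List.Relation.Unary.Unique.Propositional using (Unique)
open import Data.List.Relation.Unary.Unique.Propositional.Properties as Unique using (allFin⁺)
open import Data.List.Relation.Binary.Subset.Propositional using (_⊆_)
open import Relation.Binary.Definitions using (DecidableEquality)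
open import Relation.Binary.PropositionalEquality
open import Relation.Nullary using (¬_; ¬?; Dec; yes; no)
open import Relation.Nullary.Decidable using (map′)
open import Function using (_∘_; case_of_; flip)

module _ {A : Set} where

  ∈-─ : ∀ {x y : A} {ys} (x∈ys : x ∈ ys) → y ∈ ys → x ≢ y → y ∈ (ys ─ x∈ys)
  ∈-─ (here refl)  (here refl)  x≢y = ⊥-elim (x≢y refl)
  ∈-─ (here _)     (there y∈ys) _   = y∈ys
  ∈-─ (there _)    (here refl)  _   = here refl
  ∈-─ (there x∈ys) (there y∈ys) x≢y = there (∈-─ x∈ys y∈ys x≢y)

  length-─ : ∀ {x : A} {ys} (x∈ys : x ∈ ys) → length ys ≡ suc (length (ys ─ x∈ys))
  length-─ {ys = ys} x∈ys = length-removeAt′ ys (Any.index x∈ys)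

  length-mono-⊆ : ∀ {xs ys : List A} → Unique xs → xs ⊆ ys → length xs ≤ length ys
  length-mono-⊆ [] _ = z≤n
  length-mono-⊆ {x ∷ xs} {ys} (x∉xs ∷ xs!) xs⊆ys =
    ≤-trans (s≤s (length-mono-⊆ xs! (λ y∈xs → ∈-─ x∈ys (xs⊆ys (there y∈xs)) (All.lookup x∉xs y∈xs))))
            (≤-reflexive (sym (length-─ x∈ys)))
    where
    x∈ys : x ∈ ys
    x∈ys = xs⊆ys (here refl)

module _ {A : Set} (_≟_ : DecidableEquality A) where

  length-≤-suc : ∀ {a : A} {xs zs} → Unique xs → (∀ {x} → x ∈ xs → x ≢ a → x ∈ zs) →
                 length xs ≤ suc (length zs)
  length-≤-suc [] _ = z≤n
  length-≤-suc {a} {x ∷ xs} {zs} (x∉xs ∷ xs!) xs⊆zs with x ≟ a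
  ... | yes refl = s≤s (length-mono-⊆ xs! λ y∈xs → xs⊆zs (there y∈xs) (All.lookup x∉xs y∈xs ∘ sym))
  ... | no x≢a = ≤-trans (s≤s (length-≤-suc xs! λ y∈xs y≢a →
                   ∈-─ x∈zs (xs⊆zs (there y∈xs) y≢a) (All.lookup x∉xs y∈xs)))
                 (≤-reflexive (cong suc (sym (length-─ x∈zs))))
    where
    x∈zs : x ∈ zs
    x∈zs = xs⊆zs (here refl) x≢a

  length-≤-exchange : ∀ {a b : A} {xs ys} → Unique xs → b ∈ ys → b ∉ xs →
                      (∀ {x} → x ∈ xs → x ≢ a → x ∈ ys) → length xs ≤ length ys
  length-≤-exchange xs! b∈ys b∉xs xs⊆ys =
    ≤-trans (length-≤-suc xs! λ x∈xs x≢a →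
               ∈-─ b∈ys (xs⊆ys x∈xs x≢a) λ { refl → b∉xs x∈xs })
            (≤-reflexive (sym (length-─ b∈ys)))

+-suc-comm : ∀ x y → x + suc y ≡ y + suc x
+-suc-comm x y = trans (+-suc x y) (trans (cong suc (+-comm x y)) (sym (+-suc y x)))

module Cycle (n : ℕ) .{{_ : NonZero n}} where

  pos : ℕ → Fin n
  pos x = x mod n

  toℕ-pos : ∀ x → toℕ (pos x) ≡ x % n
  toℕ-pos x = toℕ-fromℕ< (m%n<n x n)

  toℕ-pos-< : ∀ {x} → x < n → toℕ (pos x) ≡ x
  toℕ-pos-< x<n = trans (toℕ-pos _) (m<n⇒m%n≡m x<n)

  pos-toℕ : ∀ i → pos (toℕ i) ≡ i
  pos-toℕ i = toℕ-injective (toℕ-pos-< (toℕ<n i))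

  pos-cong-% : ∀ {x y} → x % n ≡ y % n → pos x ≡ pos y
  pos-cong-% {x} {y} eq = toℕ-injective (trans (toℕ-pos x) (trans eq (sym (toℕ-pos y))))

  pos-% : ∀ x → pos (x % n) ≡ pos x
  pos-% x = pos-cong-% (m%n%n≡m%n x n)

  pos-+n : ∀ x → pos (x + n) ≡ pos x
  pos-+n x = pos-cong-% ([m+n]%n≡m%n x n)

  pos-%+ : ∀ x y → pos (x % n + y) ≡ pos (x + y)
  pos-%+ x y = pos-cong-% (begin
    (x % n + y) % n          ≡⟨ %-distribˡ-+ (x % n) y n ⟩
    (x % n % n + y % n) % n  ≡⟨ cong (λ z → (z + y % n) % n) (m%n%n≡m%n x n) ⟩
    (x % n + y % n) % n      ≡⟨ %-distribˡ-+ x y n ⟨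
    (x + y) % n              ∎)
    where open ≡-Reasoning

  pos-+% : ∀ x y → pos (x + y % n) ≡ pos (x + y)
  pos-+% x y = begin
    pos (x + y % n)  ≡⟨ cong pos (+-comm x (y % n)) ⟩
    pos (y % n + x)  ≡⟨ pos-%+ y x ⟩
    pos (y + x)      ≡⟨ cong pos (+-comm y x) ⟩
    pos (x + y)      ∎
    where open ≡-Reasoning

  pos-suc-% : ∀ x → pos (suc (x % n)) ≡ pos (suc x)
  pos-suc-% x = pos-+% 1 x

  pos-surjective : ∀ p (j : Fin n) → ∃ λ t → t < n × pos (p + t) ≡ j
  pos-surjective p j = t % n , m%n<n t n , (begin
      pos (p + t % n)  ≡⟨ pos-+% p t ⟩
      pos (p + t)      ≡⟨ pos-%+ p t ⟨
      pos (a + t)      ≡⟨ cong pos a+t≡j+n ⟩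
      pos (toℕ j + n)  ≡⟨ pos-+n (toℕ j) ⟩
      pos (toℕ j)      ≡⟨ pos-toℕ j ⟩
      j                ∎)
    where
    open ≡-Reasoning
    a t : ℕ
    a = p % n
    t = toℕ j + (n ∸ a)
    a+t≡j+n : a + t ≡ toℕ j + n
    a+t≡j+n = trans (+-comm a t) (trans (+-assoc (toℕ j) (n ∸ a) a)
                (cong (toℕ j +_) (m∸n+n≡m (<⇒≤ (m%n<n p n)))))

  arc : ℕ → ℕ
  arc x = x ⊓ (n ∸ x)

  dist : Fin n → Fin n → ℕ
  dist i j = arc ∣ toℕ i - toℕ j ∣

  dist-refl : ∀ i → dist i i ≡ 0
  dist-refl i = cong arc (∣n-n∣≡0 (toℕ i))

  dist-sym : ∀ i j → dist i j ≡ dist j i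
  dist-sym i j = cong arc (∣-∣-comm (toℕ i) (toℕ j))

  arc-sym : ∀ {t} → t ≤ n → arc (n ∸ t) ≡ arc t
  arc-sym {t} t≤n = trans (cong ((n ∸ t) ⊓_) (m∸[m∸n]≡n t≤n)) (⊓-comm (n ∸ t) t)

  arc-positive : ∀ {t} → 1 ≤ t → t < n → 1 ≤ arc t
  arc-positive 1≤t t<n = ⊓-glb 1≤t (m<n⇒0<n∸m t<n)

  dist-pos-+ : ∀ a {t} → t < n → dist (pos a) (pos (a + t)) ≡ arc t
  dist-pos-+ a {t} t<n
    rewrite toℕ-pos a | sym (pos-%+ a t) with a % n + t <? n | m%n<n a n
  ... | yes a'+t<n | _ = cong arc (trans (cong (λ z → ∣ a % n - z ∣) (toℕ-pos-< a'+t<n)) (∣m-m+n∣≡n (a % n) t))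
  ... | no a'+t≮n | a'<n with m≤n⇒∃[o]m+o≡n (≮⇒≥ a'+t≮n)
  ...   | s , n+s≡a'+t = begin
      arc ∣ a' - toℕ (pos (a' + t)) ∣  ≡⟨ cong (λ z → arc ∣ a' - toℕ z ∣) pos[a'+t]≡pos[s] ⟩
      arc ∣ a' - toℕ (pos s) ∣         ≡⟨ cong (λ z → arc ∣ a' - z ∣) (toℕ-pos-< s<n) ⟩
      arc ∣ a' - s ∣                   ≡⟨ cong arc (trans (m≤n⇒∣n-m∣≡n∸m (<⇒≤ s<a')) a'∸s≡n∸t) ⟩
      arc (n ∸ t)                      ≡⟨ arc-sym (<⇒≤ t<n) ⟩
      arc t                            ∎
    where
    open ≡-Reasoning
    a' : ℕ
    a' = a % n
    pos[a'+t]≡pos[s] : pos (a' + t) ≡ pos s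
    pos[a'+t]≡pos[s] = trans (cong pos (trans (sym n+s≡a'+t) (+-comm n s))) (pos-+n s)
    s<a' : s < a'
    s<a' = +-cancelˡ-< n s a' (subst (_< n + a') (sym n+s≡a'+t)
             (subst (a' + t <_) (+-comm a' n) (+-monoʳ-< a' t<n)))
    s<n : s < n
    s<n = <-trans s<a' a'<n
    a'∸s≡n∸t : a' ∸ s ≡ n ∸ t
    a'∸s≡n∸t = begin
      a' ∸ s              ≡⟨ [m+n]∸[m+o]≡n∸o t a' s ⟨
      (t + a') ∸ (t + s)  ≡⟨ cong₂ _∸_ (trans (+-comm t a') (sym n+s≡a'+t)) (+-comm t s) ⟩
      (n + s) ∸ (s + t)   ≡⟨ cong (_∸ (s + t)) (+-comm n s) ⟩
      (s + n) ∸ (s + t)   ≡⟨ [m+n]∸[m+o]≡n∸o s n t ⟩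
      n ∸ t               ∎

  pos-+-fixed : ∀ q {u} → u < n → pos (q + u) ≡ pos q → u ≡ 0
  pos-+-fixed q {zero} _ _ = refl
  pos-+-fixed q {suc u} u<n eq = ⊥-elim (<⇒≢ (arc-positive (s≤s z≤n) u<n) (sym arc≡0))
    where
    arc≡0 : arc (suc u) ≡ 0
    arc≡0 = trans (sym (dist-pos-+ q u<n)) (trans (cong (dist (pos q)) eq) (dist-refl (pos q)))

  pos-+-≢ : ∀ q {u} → 1 ≤ u → u < n → pos q ≢ pos (q + u)
  pos-+-≢ q {suc _} _ u<n eq with pos-+-fixed q u<n (sym eq)
  ... | ()

  pos-+-injective-≤ : ∀ p {t s} → t ≤ s → s < n → pos (p + t) ≡ pos (p + s) → t ≡ s
  pos-+-injective-≤ p {t} {s} t≤s s<n eq =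
    sym (trans (sym (m+[n∸m]≡n t≤s)) (trans (cong (t +_) u≡0) (+-identityʳ t)))
    where
    p+s≡p+t+u : p + s ≡ p + t + (s ∸ t)
    p+s≡p+t+u = trans (cong (p +_) (sym (m+[n∸m]≡n t≤s))) (sym (+-assoc p t (s ∸ t)))
    u≡0 : s ∸ t ≡ 0
    u≡0 = pos-+-fixed (p + t) (≤-<-trans (m∸n≤m s t) s<n) (trans (cong pos (sym p+s≡p+t+u)) (sym eq))

  pos-+-injective : ∀ p {t s} → t < n → s < n → pos (p + t) ≡ pos (p + s) → t ≡ s
  pos-+-injective p t<n s<n eq with ≤-total _ _
  ... | inj₁ t≤s = pos-+-injective-≤ p t≤s s<n eq
  ... | inj₂ s≤t = sym (pos-+-injective-≤ p s≤t t<n (sym eq))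

  arc-lipschitz : ∀ {x y} → y ≤ n → (x ≤ suc y × y ≤ suc x) ⊎ (x + suc y ≡ n) → arc x ≤ suc (arc y)
  arc-lipschitz {x} {y} y≤n (inj₁ (x≤1+y , y≤1+x)) =
    ⊓-mono-≤ x≤1+y (≤-trans (∸-monoʳ-≤ (suc n) y≤1+x) (≤-reflexive (+-∸-assoc 1 y≤n)))
  arc-lipschitz {x} {y} _ (inj₂ x+1+y≡n) = begin
    x ⊓ (n ∸ x)        ≡⟨ cong (x ⊓_) n∸x≡1+y ⟩
    x ⊓ suc y          ≤⟨ ⊓-glb (m⊓n≤n x (suc y)) (≤-trans (m⊓n≤m x (suc y)) (m≤n⇒m≤1+n (n≤1+n x))) ⟩
    suc (y ⊓ suc x)    ≡⟨ cong (λ z → suc (y ⊓ z)) n∸y≡1+x ⟨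
    suc (y ⊓ (n ∸ y))  ∎
    where
    n∸x≡1+y : n ∸ x ≡ suc y
    n∸x≡1+y = trans (cong (_∸ x) (sym x+1+y≡n)) (m+n∸m≡n x (suc y))
    n∸y≡1+x : n ∸ y ≡ suc x
    n∸y≡1+x = trans (cong (_∸ y) (sym (trans (+-suc-comm y x) x+1+y≡n))) (m+n∸m≡n y (suc x))
    open ≤-Reasoning

  ∣-∣≤n : ∀ (i j : Fin n) → ∣ toℕ i - toℕ j ∣ ≤ n
  ∣-∣≤n i j = ≤-trans (∣m-n∣≤m⊔n (toℕ i) (toℕ j)) (<⇒≤ (⊔-lub (toℕ<n i) (toℕ<n j)))

  -- The hypothesis is PartialSun.CycSucc i j unfolded; it does not involve the leaves.
  dist-succ : ∀ {i j} t → (toℕ j ≡ suc (toℕ i)) ⊎ (toℕ i ≡ n ∸ 1 × toℕ j ≡ 0) →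
              dist i t ≤ suc (dist j t) × dist j t ≤ suc (dist i t)
  dist-succ {i} {j} t (inj₁ j≡1+i) =
    arc-lipschitz (∣-∣≤n j t) (inj₁ (step i j ∣i-j∣≡1 , step j i ∣j-i∣≡1)) ,
    arc-lipschitz (∣-∣≤n i t) (inj₁ (step j i ∣j-i∣≡1 , step i j ∣i-j∣≡1))
    where
    ∣i-j∣≡1 : ∣ toℕ i - toℕ j ∣ ≡ 1
    ∣i-j∣≡1 = trans (cong (λ z → ∣ toℕ i - z ∣) (trans j≡1+i (+-comm 1 (toℕ i)))) (∣m-m+n∣≡n (toℕ i) 1)
    ∣j-i∣≡1 : ∣ toℕ j - toℕ i ∣ ≡ 1
    ∣j-i∣≡1 = trans (∣-∣-comm (toℕ j) (toℕ i)) ∣i-j∣≡1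
    step : ∀ a b → ∣ toℕ a - toℕ b ∣ ≡ 1 → ∣ toℕ a - toℕ t ∣ ≤ suc ∣ toℕ b - toℕ t ∣
    step a b ∣a-b∣≡1 = ≤-trans (∣-∣-triangle (toℕ a) (toℕ b) (toℕ t))
                         (≤-reflexive (cong (_+ ∣ toℕ b - toℕ t ∣) ∣a-b∣≡1))
  dist-succ {i} {j} t (inj₂ (i≡n∸1 , j≡0)) =
    arc-lipschitz (∣-∣≤n j t) (inj₂ wrap) , arc-lipschitz (∣-∣≤n i t) (inj₂ wrap′)
    where
    t≤n∸1 : toℕ t ≤ n ∸ 1
    t≤n∸1 = <⇒≤pred (toℕ<n t)
    wrap : ∣ toℕ i - toℕ t ∣ + suc ∣ toℕ j - toℕ t ∣ ≡ n
    wrap rewrite i≡n∸1 | j≡0 = begin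
      ∣ n ∸ 1 - toℕ t ∣ + suc (toℕ t)  ≡⟨ cong (_+ suc (toℕ t)) (m≤n⇒∣n-m∣≡n∸m t≤n∸1) ⟩
      (n ∸ 1 ∸ toℕ t) + suc (toℕ t)    ≡⟨ +-suc (n ∸ 1 ∸ toℕ t) (toℕ t) ⟩
      suc (n ∸ 1 ∸ toℕ t + toℕ t)      ≡⟨ cong suc (m∸n+n≡m t≤n∸1) ⟩
      suc (n ∸ 1)                       ≡⟨ suc-pred n ⟩
      n                                 ∎
      where open ≡-Reasoning
    wrap′ : ∣ toℕ j - toℕ t ∣ + suc ∣ toℕ i - toℕ t ∣ ≡ n
    wrap′ = trans (+-suc-comm ∣ toℕ j - toℕ t ∣ ∣ toℕ i - toℕ t ∣) wrap

module Sweep {B L : ℕ → Set}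
  (up   : ∀ x → B x → B (suc x) → L (suc x) → B (suc (suc x)))
  (down : ∀ x → B (suc (suc x)) → B (suc x) → L (suc x) → B x) where

  sweep-up : ∀ c → (∀ i → 1 ≤ i → i < c → L i) → B 0 → B 1 → ∀ t → t ≤ c → B t
  sweep-up c L< b₀ b₁ zero          _      = b₀
  sweep-up c L< b₀ b₁ (suc zero)    _      = b₁
  sweep-up c L< b₀ b₁ (suc (suc t)) 2+t≤c =
    up t (sweep-up c L< b₀ b₁ t (≤-trans (n≤1+n t) (≤-trans (n≤1+n (suc t)) 2+t≤c)))
         (sweep-up c L< b₀ b₁ (suc t) (≤-trans (n≤1+n (suc t)) 2+t≤c))
         (L< (suc t) (s≤s z≤n) 2+t≤c)

  -- u is the distance of t below the top index suc M.
  sweep-down : ∀ c M → (∀ i → c < i → i ≤ M → L i) → B M → B (suc M) →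
               ∀ u t → t + u ≡ suc M → c ≤ t → B t
  sweep-down c M L> b b′ zero t t+0≡1+M _ = subst B (sym (trans (sym (+-identityʳ t)) t+0≡1+M)) b′
  sweep-down c M L> b b′ (suc zero) t t+1≡1+M _ = subst B (sym (suc-injective (trans (+-comm 1 t) t+1≡1+M))) b
  sweep-down c M L> b b′ (suc (suc u)) t t+2+u≡1+M c≤t =
    down t (sweep-down c M L> b b′ u (suc (suc t)) 2+t+u≡1+M (≤-trans c≤t (m≤n+m t 2)))
           (sweep-down c M L> b b′ (suc u) (suc t) 1+t+1+u≡1+M (≤-trans c≤t (n≤1+n t)))
           (L> (suc t) (s≤s c≤t) 1+t≤M)
    where
    1+t+1+u≡1+M : suc t + suc u ≡ suc M
    1+t+1+u≡1+M = trans (sym (+-suc t (suc u))) t+2+u≡1+M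
    2+t+u≡1+M : suc (suc t) + u ≡ suc M
    2+t+u≡1+M = trans (sym (+-suc (suc t) u)) 1+t+1+u≡1+M
    1+t≤M : suc t ≤ M
    1+t≤M = ≤-pred (subst (suc (suc t) ≤_) 2+t+u≡1+M (m≤m+n (suc (suc t)) u))

  sweep : ∀ c M → c ≤ M → B 0 → B 1 → B M → B (suc M) →
          (∀ i → 1 ≤ i → i ≤ M → i ≢ c → L i) → ∀ t → t ≤ M → B t
  sweep c M c≤M b₀ b₁ b b′ L≢ t t≤M with t ≤? c
  ... | yes t≤c = sweep-up c (λ i 1≤i i<c → L≢ i 1≤i (≤-trans (<⇒≤ i<c) c≤M) (<⇒≢ i<c)) b₀ b₁ t t≤c
  ... | no t≰c = sweep-down c M (λ i c<i i≤M → L≢ i (≤-trans (s≤s z≤n) c<i) i≤M (≢-sym (<⇒≢ c<i))) b b′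
                   (suc M ∸ t) t (m+[n∸m]≡n (m≤n⇒m≤1+n t≤M)) (<⇒≤ (≰⇒> t≰c))

module Sun (k : ℕ) (U : Subset (suc (suc (suc k)))) where

  n : ℕ
  n = suc (suc (suc k))

  open PartialSun n U
  open Cycle n

  V : ℕ → Vtx
  V x = cyc (pos x)

  cycSucc-next : ∀ i → CycSucc i (pos (suc (toℕ i)))
  cycSucc-next i with suc (toℕ i) <? n
  ... | yes 1+i<n = inj₁ (toℕ-pos-< 1+i<n)
  ... | no 1+i≮n = inj₂ (cong pred 1+i≡n , trans (cong (toℕ ∘ pos) 1+i≡n) (trans (toℕ-pos n) (n%n≡0 n)))
    where
    1+i≡n : suc (toℕ i) ≡ n
    1+i≡n = ≤-antisym (toℕ<n i) (≮⇒≥ 1+i≮n)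

  cycSucc-pos : ∀ x → CycSucc (pos x) (pos (suc x))
  cycSucc-pos x = subst (CycSucc (pos x)) (trans (cong (pos ∘ suc) (toℕ-pos x)) (pos-suc-% x)) (cycSucc-next (pos x))

  cycSucc⇒next : ∀ {i j} → CycSucc i j → j ≡ pos (suc (toℕ i))
  cycSucc⇒next {i} {j} (inj₁ j≡1+i) = trans (sym (pos-toℕ j)) (cong pos j≡1+i)
  cycSucc⇒next {i} {j} (inj₂ (i≡n∸1 , j≡0)) = begin
    j                   ≡⟨ pos-toℕ j ⟨
    pos (toℕ j)         ≡⟨ cong pos j≡0 ⟩
    pos 0               ≡⟨ pos-+n 0 ⟨
    pos n               ≡⟨ cong pos (suc-pred n) ⟨
    pos (suc (n ∸ 1))   ≡⟨ cong (pos ∘ suc) i≡n∸1 ⟨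
    pos (suc (toℕ i))   ∎
    where open ≡-Reasoning

  adj-V : ∀ x → Adj (V x) (V (suc x))
  adj-V x = inj₁ (cycSucc-pos x)

  adj-V⁻ : ∀ x → Adj (V (suc x)) (V x)
  adj-V⁻ x = inj₂ (cycSucc-pos x)

  cycle-neighbours : ∀ x {j} → Adj (V (suc x)) (cyc j) → j ≡ pos (suc (suc x)) ⊎ j ≡ pos x
  cycle-neighbours x (inj₁ s) =
    inj₁ (trans (cycSucc⇒next s) (trans (cong (pos ∘ suc) (toℕ-pos (suc x))) (pos-suc-% (suc x))))
  cycle-neighbours x {j} (inj₂ s) = inj₂ (begin
    j            ≡⟨ pos-toℕ j ⟨
    pos (toℕ j)  ≡⟨ cong pos (sym x%n≡j) ⟩
    pos (x % n)  ≡⟨ pos-% x ⟩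
    pos x        ∎)
    where
    open ≡-Reasoning
    x%n≡j : x % n ≡ toℕ j
    x%n≡j = pos-+-injective 1 (m%n<n x n) (toℕ<n j) (trans (pos-suc-% x) (cycSucc⇒next s))

  infixr 5 _++ʷ_
  _++ʷ_ : ∀ {x y z a b} → Walk x y a → Walk y z b → Walk x z (a + b)
  []      ++ʷ w = w
  (e ∷ v) ++ʷ w = e ∷ (v ++ʷ w)

  split-walk : ∀ {u x z l} (w : Walk x z l) → OnWalk u w →
               ∃₂ λ p q → Walk x u p × Walk u z q × p + q ≡ l
  split-walk {l = l} w (here .w) = 0 , l , [] , w , refl
  split-walk (e ∷ w) (there .e u∈w) with split-walk w u∈w
  ... | p , q , w₁ , w₂ , p+q≡l = suc p , q , e ∷ w₁ , w₂ , cong suc p+q≡l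

  walk-up : ∀ x t → Walk (V x) (V (x + t)) t
  walk-up x zero    = subst (λ z → Walk (V x) (V z) 0) (sym (+-identityʳ x)) []
  walk-up x (suc t) = adj-V x ∷ subst (λ z → Walk (V (suc x)) (V z) t) (sym (+-suc x t)) (walk-up (suc x) t)

  walk-down : ∀ x t → Walk (V (x + t)) (V x) t
  walk-down x zero    = subst (λ z → Walk (V z) (V x) 0) (sym (+-identityʳ x)) []
  walk-down x (suc t) = subst (λ z → Walk (V z) (V x) (suc t)) (sym (+-suc x t)) (adj-V⁻ (x + t) ∷ walk-down x t)

  Walk≤ : Vtx → Vtx → ℕ → Set
  Walk≤ x y K = ∃ λ l → l ≤ K × Walk x y l

  m : ℕ
  m = ⌊ n /2⌋

  n∸t≤m : ∀ {t} → m < t → n ∸ t ≤ m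
  n∸t≤m m<t = ≤-trans (∸-monoʳ-≤ n m<t) (m≤n+o⇒m∸n≤o n (suc m) n≤1+m+m)
    where
    n≤1+m+m : n ≤ suc m + m
    n≤1+m+m = begin
      n            ≡⟨ ⌊n/2⌋+⌈n/2⌉≡n n ⟨
      m + ⌈ n /2⌉  ≤⟨ +-monoʳ-≤ m (⌊n/2⌋-mono (n≤1+n (suc n))) ⟩
      m + suc m    ≡⟨ +-suc m m ⟩
      suc m + m    ∎
      where open ≤-Reasoning

  cycle-walk : ∀ i j → Walk≤ (cyc i) (cyc j) m
  cycle-walk i j with pos-surjective (toℕ i) j
  ... | t , t<n , i+t≡j with t ≤? m
  ...   | yes t≤m = t , t≤m , subst₂ (λ a b → Walk (cyc a) (cyc b) t) (pos-toℕ i) i+t≡j (walk-up (toℕ i) t)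
  ...   | no t≰m = n ∸ t , n∸t≤m (≰⇒> t≰m) ,
                   subst₂ (λ a b → Walk (cyc a) (cyc b) (n ∸ t)) i+t+[n∸t]≡i i+t≡j
                          (walk-down (toℕ i + t) (n ∸ t))
    where
    i+t+[n∸t]≡i : pos (toℕ i + t + (n ∸ t)) ≡ i
    i+t+[n∸t]≡i = trans (cong pos (trans (+-assoc (toℕ i) t (n ∸ t)) (cong (toℕ i +_) (m+[n∸m]≡n (<⇒≤ t<n)))))
                        (trans (pos-+n (toℕ i)) (pos-toℕ i))

  leaf-cycle-walk : ∀ i pi j → Walk≤ (leaf i pi) (cyc j) (suc m)
  leaf-cycle-walk i pi j with cycle-walk i j
  ... | l , l≤m , w = suc l , s≤s l≤m , refl ∷ w

  leaf-leaf-walk : ∀ i pi j pj → Walk≤ (leaf i pi) (leaf j pj) (suc (suc m))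
  leaf-leaf-walk i pi j pj with leaf-cycle-walk i pi j
  ... | l , l≤1+m , w = l + 1 , ≤-trans (≤-reflexive (+-comm l 1)) (s≤s l≤1+m) , w ++ʷ refl ∷ []

  -- A lower bound for the distance in the sun, 1-Lipschitz along edges; it is exact
  -- except between two distinct leaves, where it is 2 too small.
  δ : Vtx → Vtx → ℕ
  δ (cyc i)    (cyc j)    = dist i j
  δ (cyc i)    (leaf j _) = suc (dist i j)
  δ (leaf i _) (cyc j)    = suc (dist i j)
  δ (leaf i _) (leaf j _) = dist i j

  δ-refl : ∀ x → δ x x ≡ 0
  δ-refl (cyc i)    = dist-refl i
  δ-refl (leaf i _) = dist-refl i

  δ-lipschitz : ∀ {x y} z → Adj x y → δ x z ≤ suc (δ y z)
  δ-lipschitz {cyc _} {cyc _}    (cyc t)    (inj₁ s) = proj₁ (dist-succ t s)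
  δ-lipschitz {cyc _} {cyc _}    (cyc t)    (inj₂ s) = proj₂ (dist-succ t s)
  δ-lipschitz {cyc _} {cyc _}    (leaf t _) (inj₁ s) = s≤s (proj₁ (dist-succ t s))
  δ-lipschitz {cyc _} {cyc _}    (leaf t _) (inj₂ s) = s≤s (proj₂ (dist-succ t s))
  δ-lipschitz {cyc _} {leaf _ _} (cyc _)    refl     = m≤n⇒m≤1+n (n≤1+n _)
  δ-lipschitz {cyc _} {leaf _ _} (leaf _ _) refl     = ≤-refl
  δ-lipschitz {leaf _ _} {cyc _} (cyc _)    refl     = ≤-refl
  δ-lipschitz {leaf _ _} {cyc _} (leaf _ _) refl     = m≤n⇒m≤1+n (n≤1+n _)

  δ≤length : ∀ {x y l} → Walk x y l → δ x y ≤ l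
  δ≤length {x} []                   = ≤-reflexive (δ-refl x)
  δ≤length {y = z} (e ∷ w)           = ≤-trans (δ-lipschitz z e) (s≤s (δ≤length w))

  δ-on-shortest-path : ∀ {x z u K} → Walk≤ x z K → OnShortestPath x z u → δ x u + δ u z ≤ K
  δ-on-shortest-path {x} {z} {u} (l , l≤K , w′) (l′ , w , shortest , u∈w) with split-walk w u∈w
  ... | p , q , w₁ , w₂ , p+q≡l′ = begin
    δ x u + δ u z  ≤⟨ +-mono-≤ (δ≤length w₁) (δ≤length w₂) ⟩
    p + q          ≡⟨ p+q≡l′ ⟩
    l′             ≤⟨ shortest w′ ⟩
    l              ≤⟨ l≤K ⟩
    _              ∎
    where open ≤-Reasoning

  ¬strongly-resolves : ∀ {x u v K L} → Walk≤ x v K → K < δ x u + δ u v →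
                       Walk≤ x u L → L < δ x v + δ v u → ¬ StronglyResolves x u v
  ¬strongly-resolves x⇝v K< _   _  (inj₁ u-on) = <⇒≱ K< (δ-on-shortest-path x⇝v u-on)
  ¬strongly-resolves _   _  x⇝u L< (inj₂ v-on) = <⇒≱ L< (δ-on-shortest-path x⇝u v-on)

  base : Vtx → Fin n
  base (cyc i)    = i
  base (leaf i _) = i

  1≤m : 1 ≤ m
  1≤m = s≤s z≤n

  n∸m≡⌈n/2⌉ : n ∸ m ≡ ⌈ n /2⌉
  n∸m≡⌈n/2⌉ = trans (cong (_∸ m) (sym (⌊n/2⌋+⌈n/2⌉≡n n))) (m+n∸m≡n m ⌈ n /2⌉)

  m≤n∸m : m ≤ n ∸ m
  m≤n∸m = subst (m ≤_) (sym n∸m≡⌈n/2⌉) (⌊n/2⌋≤⌈n/2⌉ n)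

  m<n : m < n
  m<n = ⌊n/2⌋<n (2 + k)

  1+m<n : suc m < n
  1+m<n = s≤s (s≤s (⌊n/2⌋<n k))

  arc-m : arc m ≡ m
  arc-m = m≤n⇒m⊓n≡m m≤n∸m

  dist-pos-suc : ∀ y → 1 ≤ dist (pos y) (pos (suc y))
  dist-pos-suc y = subst (λ z → 1 ≤ dist (pos y) (pos z)) (+-comm y 1)
                     (subst (1 ≤_) (sym (dist-pos-+ y (s≤s (s≤s z≤n)))) (arc-positive ≤-refl (s≤s (s≤s z≤n))))

  dist-pos-2 : ∀ y → 1 ≤ dist (pos y) (pos (suc (suc y)))
  dist-pos-2 y = subst (λ z → 1 ≤ dist (pos y) (pos z)) (+-comm y 2)
                   (subst (1 ≤_) (sym (dist-pos-+ y 2<n)) (arc-positive (s≤s z≤n) 2<n))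
    where
    2<n : 2 < n
    2<n = s≤s (s≤s (s≤s z≤n))

  dist-≢ : ∀ {i j} → i ≢ j → 1 ≤ dist i j
  dist-≢ {i} {j} i≢j with pos-surjective (toℕ i) j
  ... | zero , _ , i+0≡j =
    ⊥-elim (i≢j (trans (sym (pos-toℕ i)) (trans (cong pos (sym (+-identityʳ (toℕ i)))) i+0≡j)))
  ... | suc t , t<n , i+t≡j = subst₂ (λ a b → 1 ≤ dist a b) (pos-toℕ i) i+t≡j
                                (subst (1 ≤_) (sym (dist-pos-+ (toℕ i) t<n)) (arc-positive (s≤s z≤n) t<n))

  ¬resolves-neighbours : ∀ y x → base x ≡ pos (suc y) → ¬ StronglyResolves x (V y) (V (suc (suc y)))
  ¬resolves-neighbours y (cyc _) refl =
    ¬strongly-resolves (1 , ≤-refl , adj-V (suc y) ∷ [])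
      (+-mono-≤ (subst (1 ≤_) (dist-sym (pos y) _) (dist-pos-suc y)) (dist-pos-2 y))
      (1 , ≤-refl , adj-V⁻ y ∷ [])
      (+-mono-≤ (dist-pos-suc (suc y)) (subst (1 ≤_) (dist-sym (pos y) _) (dist-pos-2 y)))
  ¬resolves-neighbours y (leaf _ _) refl =
    ¬strongly-resolves (2 , ≤-refl , refl ∷ adj-V (suc y) ∷ [])
      (+-mono-≤ (s≤s (subst (1 ≤_) (dist-sym (pos y) _) (dist-pos-suc y))) (dist-pos-2 y))
      (2 , ≤-refl , refl ∷ adj-V⁻ y ∷ [])
      (+-mono-≤ (s≤s (dist-pos-suc (suc y))) (subst (1 ≤_) (dist-sym (pos y) _) (dist-pos-2 y)))

  no-single-resolver : ∀ x → ∃₂ λ u v → u ≢ v × ¬ StronglyResolves x u v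
  no-single-resolver x = V y , V (suc (suc y)) , V≢V , ¬resolves-neighbours y x base≡
    where
    y : ℕ
    y = toℕ (base x) + (n ∸ 1)
    base≡ : base x ≡ pos (suc y)
    base≡ = sym (begin
      pos (suc (toℕ (base x) + (n ∸ 1)))  ≡⟨ cong pos (+-suc (toℕ (base x)) (n ∸ 1)) ⟨
      pos (toℕ (base x) + suc (n ∸ 1))    ≡⟨ cong (λ z → pos (toℕ (base x) + z)) (suc-pred n) ⟩
      pos (toℕ (base x) + n)              ≡⟨ pos-+n (toℕ (base x)) ⟩
      pos (toℕ (base x))                  ≡⟨ pos-toℕ (base x) ⟩
      base x                              ∎)
      where open ≡-Reasoning
    V≢V : V y ≢ V (suc (suc y))
    V≢V eq = <⇒≢ (dist-pos-2 y) (sym (trans (cong (dist (pos y) ∘ base) (sym eq)) (dist-refl (pos y))))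

  two-resolvers : ∀ {W} → IsStrongResolvingSet W → 2 ≤ length W
  two-resolvers {[]} res with no-single-resolver (V 0)
  ... | u , v , u≢v , _ with res u v u≢v
  ... | _ , () , _
  two-resolvers {x ∷ []} res with no-single-resolver x
  ... | u , v , u≢v , ¬res with res u v u≢v
  ... | _ , here refl , r = ⊥-elim (¬res r)
  two-resolvers {_ ∷ _ ∷ _} _ = s≤s (s≤s z≤n)

  walk-into-leaf : ∀ {x i pi l} → Walk x (leaf i pi) (suc l) → Walk x (cyc i) l
  walk-into-leaf {cyc _}    (refl ∷ [])    = []
  walk-into-leaf {leaf _ _} (() ∷ [])
  walk-into-leaf            (e ∷ e′ ∷ w)  = e ∷ walk-into-leaf (e′ ∷ w)

  leaf-on-shortest-path : ∀ {x i pi j pj} → i ≢ j → OnShortestPath x (leaf j pj) (leaf i pi) → x ≡ leaf i pi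
  leaf-on-shortest-path {x} {j = j} {pj} i≢j (l , w , shortest , on) with split-walk w on
  ... | zero  , _     , [] , _                          , _        = refl
  ... | suc _ , zero  , _  , []                         , _        = ⊥-elim (i≢j refl)
  ... | suc p , suc q , w₁ , _∷_ {y = cyc _} refl w₂ , 2+p+q≡l = ⊥-elim (<⇒≱ shortcut-shorter (shortest shortcut))
    where
    shortcut : Walk x (leaf j pj) (p + q)
    shortcut = walk-into-leaf w₁ ++ʷ w₂
    shortcut-shorter : p + q < l
    shortcut-shorter = subst (suc (p + q) ≤_) (trans (cong suc (sym (+-suc p q))) 2+p+q≡l) (n≤1+n _)

  leaf-pair-resolvers : ∀ {x i pi j pj} → i ≢ j → StronglyResolves x (leaf i pi) (leaf j pj) →
                        x ≡ leaf i pi ⊎ x ≡ leaf j pj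
  leaf-pair-resolvers i≢j (inj₁ on) = inj₁ (leaf-on-shortest-path i≢j on)
  leaf-pair-resolvers i≢j (inj₂ on) = inj₂ (leaf-on-shortest-path (i≢j ∘ sym) on)

  ¬leaf-resolves-leaf-cycle : ∀ {i pi j pj b} → i ≢ j → i ≢ b → m ≤ dist j b →
                              ¬ StronglyResolves (leaf i pi) (leaf j pj) (cyc b)
  ¬leaf-resolves-leaf-cycle {i} {pi} {j} {pj} {b} i≢j i≢b m≤jb =
    ¬strongly-resolves (leaf-cycle-walk i pi b) (+-mono-≤ (dist-≢ i≢j) (s≤s m≤jb))
                       (leaf-leaf-walk i pi j pj)
                       (+-mono-≤ (s≤s (dist-≢ i≢b)) (s≤s (subst (m ≤_) (dist-sym j b) m≤jb)))

  ¬leaf-resolves-cycle-cycle : ∀ {i pi a b} → i ≢ a → i ≢ b → m ≤ dist a b →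
                               ¬ StronglyResolves (leaf i pi) (cyc a) (cyc b)
  ¬leaf-resolves-cycle-cycle {i} {pi} {a} {b} i≢a i≢b m≤ab =
    ¬strongly-resolves (leaf-cycle-walk i pi b) (+-mono-≤ (s≤s (dist-≢ i≢a)) m≤ab)
                       (leaf-cycle-walk i pi a) (+-mono-≤ (s≤s (dist-≢ i≢b)) (subst (m ≤_) (dist-sym a b) m≤ab))

  leaf-irrelevant : ∀ {i j} (pi : i ∈ₛ U) (pj : j ∈ₛ U) → i ≡ j → leaf i pi ≡ leaf j pj
  leaf-irrelevant pi pj refl = cong (leaf _) ([]=-irrelevant pi pj)

  LeafBlack : List Vtx → Fin n → Set
  LeafBlack S i = ∀ pi → Black S (leaf i pi)

  force-along : ∀ {S} x {a b} → (∀ {j} → Adj (V (suc x)) (cyc j) → j ≢ b → j ≡ a) →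
                Adj (V (suc x)) (cyc b) → Black S (V (suc x)) → LeafBlack S (pos (suc x)) → Black S (cyc a) → Black S (cyc b)
  force-along {S} x {a} {b} other x~b black-x black-leaf black-a = force black-x x~b rest-black
    where
    rest-black : ∀ w → Adj (V (suc x)) w → w ≢ cyc b → Black S w
    rest-black (cyc j)    x~j j≢b = subst (Black S ∘ cyc) (sym (other x~j (j≢b ∘ cong cyc))) black-a
    rest-black (leaf _ _) refl _  = black-leaf _

  force-up : ∀ {S} x → Black S (V x) → Black S (V (suc x)) → LeafBlack S (pos (suc x)) → Black S (V (suc (suc x)))
  force-up x black-x black-x+1 black-leaf = force-along x other (adj-V (suc x)) black-x+1 black-leaf black-x
    where
    other : ∀ {j} → Adj (V (suc x)) (cyc j) → j ≢ pos (suc (suc x)) → j ≡ pos x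
    other x~j j≢ with cycle-neighbours x x~j
    ... | inj₁ j≡ = ⊥-elim (j≢ j≡)
    ... | inj₂ j≡ = j≡

  force-down : ∀ {S} x → Black S (V (suc (suc x))) → Black S (V (suc x)) → LeafBlack S (pos (suc x)) → Black S (V x)
  force-down x black-x+2 black-x+1 black-leaf = force-along x other (adj-V⁻ x) black-x+1 black-leaf black-x+2
    where
    other : ∀ {j} → Adj (V (suc x)) (cyc j) → j ≢ pos x → j ≡ pos (suc (suc x))
    other x~j j≢ with cycle-neighbours x x~j
    ... | inj₁ j≡ = j≡
    ... | inj₂ j≡ = ⊥-elim (j≢ j≡)

  force-by-leaf : ∀ {S i pi} → Black S (leaf i pi) → Black S (cyc i)
  force-by-leaf {S} {i} {pi} black-leaf = force black-leaf refl only
    where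
    only : ∀ w → Adj (leaf i pi) w → w ≢ cyc i → Black S w
    only (cyc _) refl i≢i = ⊥-elim (i≢i refl)

  cycle-black⇒zero-forcing : ∀ {S} → (∀ j → Black S (cyc j)) → IsZeroForcingSet S
  cycle-black⇒zero-forcing cycle-black (cyc j) = cycle-black j
  cycle-black⇒zero-forcing {S} cycle-black (leaf j pj) = force (cycle-black j) refl only
    where
    only : ∀ w → Adj (cyc j) w → w ≢ leaf j pj → Black S w
    only (cyc j′)     _    _   = cycle-black j′
    only (leaf _ pj′) refl j≢j = ⊥-elim (j≢j (leaf-irrelevant pj′ pj refl))

  zero-forcing-set : ∀ {S} p (j₀ : Fin n) → Black S (V p) → Black S (V (suc p)) →
                     (∀ j → j ≢ j₀ → LeafBlack S j) → IsZeroForcingSet S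
  zero-forcing-set {S} p j₀ black₀ black₁ black-leaves with pos-surjective (suc p) j₀
  ... | c , c<n , p+1+c≡j₀ = cycle-black⇒zero-forcing cycle-black
    where
    -- Indices count from p: the leaf that may be white sits at index suc c ∈ [1, n], and
    -- the indices n and suc n are the black pair again.
    open Sweep {λ t → Black S (V (t + p))} {λ t → LeafBlack S (pos (t + p))}
               (λ x → force-up (x + p)) (λ x → force-down (x + p))
    shift : ∀ t → pos (suc t + p) ≡ pos (suc p + t)
    shift t = cong (pos ∘ suc) (+-comm t p)
    black-n : Black S (V (n + p))
    black-n = subst (Black S ∘ cyc) (sym (trans (cong pos (+-comm n p)) (pos-+n p))) black₀
    black-n+1 : Black S (V (suc n + p))
    black-n+1 = subst (Black S ∘ cyc) (sym (trans (shift n) (pos-+n (suc p)))) black₁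
    leaves-black : ∀ i → 1 ≤ i → i ≤ n → i ≢ suc c → LeafBlack S (pos (i + p))
    leaves-black (suc i) _ i<n i≢c = black-leaves _ λ eq →
      i≢c (cong suc (pos-+-injective (suc p) i<n c<n (trans (sym (shift i)) (trans eq (sym p+1+c≡j₀)))))
    cycle-black : ∀ j → Black S (cyc j)
    cycle-black j with pos-surjective p j
    ... | t , t<n , p+t≡j = subst (Black S ∘ cyc) (trans (cong pos (+-comm t p)) p+t≡j)
                              (sweep (suc c) n c<n black₀ black₁ black-n black-n+1 leaves-black t (<⇒≤ t<n))

  _≟ᵛ_ : DecidableEquality Vtx
  cyc i     ≟ᵛ cyc j     = map′ (cong cyc) (cong base) (i ≟ᶠ j)
  cyc _     ≟ᵛ leaf _ _  = no λ ()
  leaf _ _  ≟ᵛ cyc _     = no λ ()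
  leaf i pi ≟ᵛ leaf j pj = map′ (leaf-irrelevant pi pj) (cong base) (i ≟ᶠ j)

  open DecMembership _≟ᵛ_ using (_∈?_)

  IsLeaf : Vtx → Set
  IsLeaf v = ∃₂ λ i (pi : i ∈ₛ U) → v ≡ leaf i pi

  IsCycle : Vtx → Set
  IsCycle v = ∃ λ i → v ≡ cyc i

  isCycle? : ∀ v → Dec (IsCycle v)
  isCycle? (cyc i)    = yes (i , refl)
  isCycle? (leaf _ _) = no λ ()

  -- cyc i is a junk value: vertex-over is only applied to positions i ∈ U.
  vertex-over-with : ∀ i → Dec (i ∈ₛ U) → Vtx
  vertex-over-with i (yes pi) = leaf i pi
  vertex-over-with i (no _)   = cyc i

  vertex-over : Fin n → Vtx
  vertex-over i = vertex-over-with i (i ∈ₛ? U)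

  base-vertex-over : ∀ i → base (vertex-over i) ≡ i
  base-vertex-over i = base-with (i ∈ₛ? U)
    where
    base-with : (d : Dec (i ∈ₛ U)) → base (vertex-over-with i d) ≡ i
    base-with (yes _) = refl
    base-with (no _)  = refl

  vertex-over-leaf : ∀ {i} (pi : i ∈ₛ U) → vertex-over i ≡ leaf i pi
  vertex-over-leaf {i} pi = leaf-with (i ∈ₛ? U)
    where
    leaf-with : (d : Dec (i ∈ₛ U)) → vertex-over-with i d ≡ leaf i pi
    leaf-with (yes pi′) = leaf-irrelevant pi′ pi refl
    leaf-with (no i∉U)  = ⊥-elim (i∉U pi)

  leaves : List Vtx
  leaves = map vertex-over (filter (_∈ₛ? U) (allFin n))

  leaves-unique : Unique leaves
  leaves-unique = Unique.map⁺ (λ {i} {j} eq → trans (sym (base-vertex-over i)) (trans (cong base eq) (base-vertex-over j)))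
                              (Unique.filter⁺ (_∈ₛ? U) {allFin n} (allFin⁺ n))

  leaf∈leaves : ∀ {i} (pi : i ∈ₛ U) → leaf i pi ∈ leaves
  leaf∈leaves {i} pi = ∈-map∘filter⁺ vertex-over (_∈ₛ? U) (i , ∈-allFin i , sym (vertex-over-leaf pi) , pi)

  leaves-are-leaves : ∀ {v} → v ∈ leaves → IsLeaf v
  leaves-are-leaves v∈ with ∈-map∘filter⁻ vertex-over (_∈ₛ? U) {xs = allFin n} v∈
  ... | i , _ , refl , pi = i , pi , vertex-over-leaf pi

  leaves-except : Vtx → List Vtx
  leaves-except v = filter (λ w → ¬? (w ≟ᵛ v)) leaves

  ZeroForcingWithin : ℕ → Set
  ZeroForcingWithin K = ∃ λ S → Unique S × IsZeroForcingSet S × length S ≤ K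

  weaken : ∀ {K K′} → K ≤ K′ → ZeroForcingWithin K → ZeroForcingWithin K′
  weaken K≤K′ (S , S! , zfs , |S|≤K) = S , S! , zfs , ≤-trans |S|≤K K≤K′

  V≢V-suc : ∀ x → V x ≢ V (suc x)
  V≢V-suc x eq = <⇒≢ (dist-pos-suc x) (sym (trans (cong (dist (pos x) ∘ base) (sym eq)) (dist-refl (pos x))))

  cycle-pair-unique : ∀ x → Unique (V x ∷ V (suc x) ∷ [])
  cycle-pair-unique x = (V≢V-suc x All.∷ All.[]) ∷ (All.[] ∷ [])

  zero-forcing-from-leaf-list : ∀ ls → Unique ls → (∀ {i} (pi : i ∈ₛ U) → leaf i pi ∈ ls) → All IsLeaf ls →
                                ZeroForcingWithin (2 ⊔ length ls)
  zero-forcing-from-leaf-list [] _ all-in _ =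
    V 0 ∷ V 1 ∷ [] , cycle-pair-unique 0 ,
    zero-forcing-set 0 (pos 0) (initial (here refl)) (initial (there (here refl))) (λ _ _ pj → case all-in pj of λ ()) ,
    ≤-refl
  zero-forcing-from-leaf-list (_ ∷ []) _ all-in ((a , _ , refl) All.∷ _) =
    V (toℕ a) ∷ V (suc (toℕ a)) ∷ [] , cycle-pair-unique (toℕ a) ,
    zero-forcing-set (toℕ a) a (initial (here refl)) (initial (there (here refl))) only-a ,
    ≤-refl
    where
    only-a : ∀ j → j ≢ a → LeafBlack _ j
    only-a j j≢a pj with all-in pj
    ... | here eq = ⊥-elim (j≢a (cong base eq))
  zero-forcing-from-leaf-list (l ∷ l′ ∷ rest) (_ ∷ l′∷rest!) all-in
                              ((a , _ , refl) All.∷ (b , _ , refl) All.∷ rest-leaves) =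
    S , S! , zero-forcing-set (toℕ b) a black-b black-b+1 except-a , m≤n⊔m 2 _
    where
    S : List Vtx
    S = V (suc (toℕ b)) ∷ l′ ∷ rest
    S! : Unique S
    S! = All.tabulate (λ {v} v∈ → cycle≢leaf (All.lookup ((b , _ , refl) All.∷ rest-leaves) v∈)) ∷ l′∷rest!
      where
      cycle≢leaf : ∀ {v} → IsLeaf v → V (suc (toℕ b)) ≢ v
      cycle≢leaf (_ , _ , refl) ()
    black-b : Black S (V (toℕ b))
    black-b = subst (Black S ∘ cyc) (sym (pos-toℕ b)) (force-by-leaf (initial (there (here refl))))
    black-b+1 : Black S (V (suc (toℕ b)))
    black-b+1 = initial (here refl)
    except-a : ∀ j → j ≢ a → LeafBlack S j
    except-a j j≢a pj with all-in pj
    ... | here eq  = ⊥-elim (j≢a (cong base eq))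
    ... | there j∈ = initial (there j∈)

  ∈-leaves-except : ∀ {v w} → w ∈ leaves → w ≢ v → w ∈ leaves-except v
  ∈-leaves-except w∈ w≢v = ∈-filter⁺ (λ w → ¬? (w ≟ᵛ _)) w∈ w≢v

  ∈-leaves-except⁻ : ∀ {v w} → w ∈ leaves-except v → w ∈ leaves × w ≢ v
  ∈-leaves-except⁻ {v} = ∈-filter⁻ (λ w → ¬? (w ≟ᵛ v)) {xs = leaves}

  leaves-except-unique : ∀ v → Unique (leaves-except v)
  leaves-except-unique v = Unique.filter⁺ (λ w → ¬? (w ≟ᵛ v)) leaves-unique

  zero-forcing-dropping : ∀ p {j₀} (pj₀ : j₀ ∈ₛ U) → pos p ∈ₛ U → pos (suc p) ∈ₛ U →
                          j₀ ≢ pos p → j₀ ≢ pos (suc p) → IsZeroForcingSet (leaves-except (leaf j₀ pj₀))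
  zero-forcing-dropping p pj₀ p∈U p+1∈U j₀≢p j₀≢p+1 =
    zero-forcing-set p _ (force-by-leaf (kept p∈U (j₀≢p ∘ sym))) (force-by-leaf (kept p+1∈U (j₀≢p+1 ∘ sym)))
      (λ j j≢j₀ pj → kept pj j≢j₀)
    where
    kept : ∀ {j} (pj : j ∈ₛ U) → j ≢ _ → Black (leaves-except (leaf _ pj₀)) (leaf j pj)
    kept pj j≢j₀ = initial (∈-leaves-except (leaf∈leaves pj) (j≢j₀ ∘ cong base))

  m≤dist-pos-+m : ∀ a → m ≤ dist (pos a) (pos (a + m))
  m≤dist-pos-+m a = ≤-reflexive (sym (trans (dist-pos-+ a m<n) arc-m))

  m≤dist-pos-∸m : ∀ a → m ≤ dist (pos a) (pos (a + (n ∸ m)))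
  m≤dist-pos-∸m a =
    ≤-reflexive (sym (trans (dist-pos-+ a (∸-monoʳ-< 1≤m (<⇒≤ m<n))) (trans (arc-sym (<⇒≤ m<n)) arc-m)))

  module _ {W} (res : IsStrongResolvingSet W) where

    from-all-leaves : length leaves ≤ length W → ZeroForcingWithin (length W)
    from-all-leaves |leaves|≤|W| =
      weaken (⊔-lub (two-resolvers res) |leaves|≤|W|)
             (zero-forcing-from-leaf-list leaves leaves-unique leaf∈leaves (All.tabulate leaves-are-leaves))

    other-leaves-resolve : ∀ {h ph} → leaf h ph ∉ W → ∀ {x} → x ∈ leaves → x ≢ leaf h ph → x ∈ W
    other-leaves-resolve {h} {ph} h∉W x∈ x≢h with leaves-are-leaves x∈
    ... | i , pi , refl = resolver-is-leaf-i (res (leaf i pi) (leaf h ph) x≢h)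
      where
      resolver-is-leaf-i : (∃ λ y → y ∈ W × StronglyResolves y (leaf i pi) (leaf h ph)) → leaf i pi ∈ W
      resolver-is-leaf-i (y , y∈W , y-res) with leaf-pair-resolvers (λ { refl → x≢h (leaf-irrelevant pi ph refl) }) y-res
      ... | inj₁ refl = y∈W
      ... | inj₂ refl = ⊥-elim (h∉W y∈W)

    module _ {h ph} (h∉W : leaf h ph ∉ W) (no-cycle : ¬ Any IsCycle W) where

      unresolved : ∀ {u v} → u ≢ v →
                   (∀ {i} (pi : i ∈ₛ U) → i ≢ h → ¬ StronglyResolves (leaf i pi) u v) → ⊥
      unresolved {u} {v} u≢v ¬res with res u v u≢v
      ... | cyc c     , c∈W , _     = no-cycle (Any.map (λ { refl → c , refl }) c∈W)
      ... | leaf i pi , i∈W , i-res =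
        ¬res pi (λ { refl → h∉W (subst (_∈ W) (leaf-irrelevant pi ph refl) i∈W) }) i-res

      a : ℕ
      a = toℕ h

      pos-a : pos a ≡ h
      pos-a = pos-toℕ h

      h≢ : ∀ {t} → 1 ≤ t → t < n → h ≢ pos (a + t)
      h≢ {t} 1≤t t<n = subst (_≢ pos (a + t)) pos-a (pos-+-≢ a 1≤t t<n)

      far-cycle-vertex-has-leaf : ∀ {b} → m ≤ dist (pos a) b → ¬ b ∉ₛ U
      far-cycle-vertex-has-leaf {b} m≤dist b∉U = unresolved {leaf h ph} {cyc b} (λ ()) λ pi i≢h →
        ¬leaf-resolves-leaf-cycle i≢h (λ { refl → b∉U pi }) (subst (λ z → m ≤ dist z b) pos-a m≤dist)

      drop-antipode : pos (suc a) ∈ₛ U → pos (a + (n ∸ m)) ∈ₛ U → ZeroForcingWithin (length W)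
      drop-antipode pa₁ pb =
        S , leaves-except-unique _ ,
        zero-forcing-dropping a pb (subst (_∈ₛ U) (sym pos-a) ph) pa₁ (b≢h ∘ flip trans pos-a) b≢a+1 ,
        length-≤-exchange _≟ᵛ_ (leaves-except-unique _) b∈W b∉S
                          (other-leaves-resolve h∉W ∘ proj₁ ∘ ∈-leaves-except⁻)
        where
        S : List Vtx
        S = leaves-except (leaf _ pb)
        n∸m<n : n ∸ m < n
        n∸m<n = ∸-monoʳ-< 1≤m (<⇒≤ m<n)
        1≤n∸m : 1 ≤ n ∸ m
        1≤n∸m = ≤-trans 1≤m m≤n∸m
        b≢h : pos (a + (n ∸ m)) ≢ h
        b≢h = h≢ 1≤n∸m n∸m<n ∘ sym
        -- n ∸ m = ⌈ n /2⌉ ≥ 2, as n ≥ 3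
        b≢a+1 : pos (a + (n ∸ m)) ≢ pos (suc a)
        b≢a+1 eq
          with trans (sym n∸m≡⌈n/2⌉) (pos-+-injective a n∸m<n (s≤s (s≤s z≤n)) (trans eq (cong pos (+-comm 1 a))))
        ... | ()
        b∈W : leaf _ pb ∈ W
        b∈W = other-leaves-resolve h∉W (leaf∈leaves pb) (b≢h ∘ cong base)
        b∉S : leaf _ pb ∉ S
        b∉S b∈S = proj₂ (∈-leaves-except⁻ b∈S) refl

      drop-h : pos (a + m) ∈ₛ U → pos (suc (a + m)) ∈ₛ U → ZeroForcingWithin (length W)
      drop-h pb pc =
        leaves-except (leaf h ph) , leaves-except-unique _ ,
        zero-forcing-dropping (a + m) ph pb pc (h≢ 1≤m m<n)
                              (h≢ (s≤s z≤n) 1+m<n ∘ flip trans (cong pos (sym (+-suc a m)))) ,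
        length-mono-⊆ (leaves-except-unique _) (uncurry (other-leaves-resolve h∉W) ∘ ∈-leaves-except⁻)

      only-leaves : ZeroForcingWithin (length W)
      only-leaves with pos (a + m) ∈ₛ? U | pos (a + (n ∸ m)) ∈ₛ? U
      ... | no b∉U | _       = ⊥-elim (far-cycle-vertex-has-leaf (m≤dist-pos-+m a) b∉U)
      ... | yes _  | no b∉U  = ⊥-elim (far-cycle-vertex-has-leaf (m≤dist-pos-∸m a) b∉U)
      ... | yes pb | yes pb′ with pos (suc a) ∈ₛ? U | pos (suc a + m) ∈ₛ? U
      ...   | yes pa₁ | _      = drop-antipode pa₁ pb′
      ...   | no _    | yes pc = drop-h pb pc
      ...   | no a₁∉U | no c∉U = ⊥-elim (unresolved (pos-+-≢ (suc a) 1≤m m<n ∘ cong base) λ pi _ →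
              ¬leaf-resolves-cycle-cycle (λ { refl → a₁∉U pi }) (λ { refl → c∉U pi }) (m≤dist-pos-+m (suc a)))

    missing-leaf : ∀ {h ph} → leaf h ph ∉ W → ZeroForcingWithin (length W)
    missing-leaf h∉W with any? isCycle? W
    ... | no no-cycle = only-leaves h∉W no-cycle
    ... | yes has-cycle with find has-cycle
    ...   | _ , c∈W , (_ , refl) = from-all-leaves
            (length-≤-exchange _≟ᵛ_ leaves-unique c∈W (λ c∈ → case leaves-are-leaves c∈ of λ { (_ , _ , ()) })
                               (other-leaves-resolve h∉W))

  theorem : ∀ W → IsStrongResolvingSet W → ZeroForcingWithin (length W)
  theorem W res with all? (_∈? W) leaves
  ... | yes leaves⊆W = from-all-leaves res (length-mono-⊆ leaves-unique (All.lookup leaves⊆W))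
  ... | no ¬leaves⊆W with find (¬All⇒Any¬ (_∈? W) leaves ¬leaves⊆W)
  ...   | _ , v∈ , v∉W with leaves-are-leaves v∈
  ...     | _ , _ , refl = missing-leaf res v∉W

corollary3p6 : (n : ℕ) → 3 ≤ n → (U : Subset n) →
    (W : List (PartialSun.Vtx n U)) → Unique W → PartialSun.IsStrongResolvingSet n U W →
    ∃ λ (S : List (PartialSun.Vtx n U)) →
    Unique S × PartialSun.IsZeroForcingSet n U S × length S ≤ length W
corollary3p6 (suc (suc (suc k))) (s≤s (s≤s (s≤s z≤n))) U W _ res = Sun.theorem k U W res
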